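{- Let $G$ be a graph of order $n$ that does not contain $C_4$ as a (not necessarily induced) subgraph. Then $\gamma_{LD}(G)\leq\overset{\rightarrow}{\Gamma}_{LD}(G)\leq n-\alpha'(G)$, where $\alpha'(G)$ is the maximum size of a matching in $G$.
   Context: For an undirected graph $G=(V,E)$, $S\subseteq V$ is a locating-dominating set if every $u\notin S$ has $N(u)\cap S\neq\emptyset$ and distinct $u,v\notin S$ satisfy $N(u)\cap S\neq N(v)\cap S$; $\gamma_{LD}(G)$ is the minimum size. For an orientation $D$ of $G$ (each edge given exactly one direction), $S$ is locating-dominating in $D$ if the same holds with $N(\cdot)$ replaced by the in-neighbourhood $N^-_D(\cdot)$; $\gamma_{LD}(D)$ is the minimum size. $\overset{\rightarrow}{\Gamma}_{LD}(G)=\max_D\gamma_{LD}(D)$ over all orientations $D$ of $G$. -}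

module Defs where

open import Data.Nat using (ℕ; _≤_)
open import Data.Fin using (Fin)
open import Data.Fin.Subset using (Subset; _∈_; _∉_; ∣_∣)
open import Data.Product using (Σ; ∃; _×_; _,_)
open import Data.Sum using (_⊎_)
open import Data.Vec using (Vec; toList)
open import Data.List using (List; []; _∷_; concatMap)
open import Data.List.Relation.Unary.All using (All)
open import Data.List.Relation.Unary.Unique.Propositional using (Unique)
open import Relation.Nullary using (¬_)
open import Relation.Binary.PropositionalEquality using (_≡_; _≢_)
open import Function.Bundles using (_⇔_)

record Graph (n : ℕ) : Set₁ where
  field
    Adj   : Fin n → Fin n → Set
    sym   : ∀ {u v} → Adj u v → Adj v u
    irrefl : ∀ {u} → ¬ Adj u u
open Graph public

-- A "neighbourhood relation" In w u means: w ∈ N(u) (undirected case)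
-- or w ∈ N⁻(u), i.e. there is an arc w → u (directed case).
Rel : ℕ → Set₁
Rel n = Fin n → Fin n → Set

IsLD : ∀ {n} → Rel n → Subset n → Set
IsLD {n} In S =
  (∀ u → u ∉ S → ∃ λ w → w ∈ S × In w u) ×
  (∀ u v → u ∉ S → v ∉ S → u ≢ v →
     ¬ (∀ w → w ∈ S → (In w u ⇔ In w v)))

IsγLD : ∀ {n} → Rel n → ℕ → Set
IsγLD {n} In k =
  (Σ (Subset n) λ S → IsLD In S × ∣ S ∣ ≡ k) ×
  (∀ S → IsLD In S → k ≤ ∣ S ∣)

record Orientation {n} (G : Graph n) : Set₁ where
  field
    Arc      : Fin n → Fin n → Set
    arc⊆edge : ∀ {u v} → Arc u v → Adj G u v
    covers   : ∀ {u v} → Adj G u v → Arc u v ⊎ Arc v u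
    antisym  : ∀ {u v} → Arc u v → ¬ Arc v u
open Orientation public

IsγLDGraph : ∀ {n} → Graph n → ℕ → Set
IsγLDGraph G k = IsγLD (Adj G) k

IsγLDOrient : ∀ {n} {G : Graph n} → Orientation G → ℕ → Set
IsγLDOrient D k = IsγLD (Arc D) k

IsΓLD : ∀ {n} → Graph n → ℕ → Set₁
IsΓLD G k =
  (Σ (Orientation G) λ D → IsγLDOrient D k) ×
  (∀ (D : Orientation G) j → IsγLDOrient D j → j ≤ k)

endpoints : ∀ {n} → List (Fin n × Fin n) → List (Fin n)
endpoints = concatMap (λ { (a , b) → a ∷ b ∷ [] })

IsMatching : ∀ {n} → Graph n → ∀ {m} → Vec (Fin n × Fin n) m → Set
IsMatching G M =
  All (λ { (a , b) → Adj G a b }) (toList M) × Unique (endpoints (toList M))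

IsMatchingNumber : ∀ {n} → Graph n → ℕ → Set
IsMatchingNumber {n} G m =
  (Σ (Vec (Fin n × Fin n) m) λ M → IsMatching G M) ×
  (∀ j (M : Vec (Fin n × Fin n) j) → IsMatching G M → j ≤ m)

ContainsC4 : ∀ {n} → Graph n → Set
ContainsC4 {n} G =
  Σ (Fin n) λ a → Σ (Fin n) λ b → Σ (Fin n) λ c → Σ (Fin n) λ d →
    (a ≢ b × a ≢ c × a ≢ d × b ≢ c × b ≢ d × c ≢ d) ×
    (Adj G a b × Adj G b c × Adj G c d × Adj G d a)

{-# OPTIONS --safe #-}
-- In a C4-free graph two distinct vertices have at most one common neighbour.
-- Lower bound: if S is locating-dominating in an orientation D, two vertices
-- outside S with equal neighbourhoods in S share a single neighbour w ∈ S; since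
-- each of them has an in-neighbour in S, w is an in-neighbour of both, so their
-- in-neighbourhoods in S coincide as well.  Upper bound: orient a maximum
-- matching along D and delete its heads.  Every head is dominated by its tail,
-- and two heads with equal in-neighbourhoods would have both tails as common
-- neighbours, so the tails coincide, contradicting that M is a matching.
module Submission where

open import Defs
open import Data.Nat using (ℕ; _≤_; _∸_; _+_; suc)
open import Data.Nat.Properties
  using (≤-reflexive; ≤-trans; +-identityʳ; +-suc; +-monoˡ-≤; m+n≤o⇒m≤o∸n; module ≤-Reasoning)
open import Data.Fin using (Fin; _≟_)
open import Data.Fin.Subset using (Subset; ⊤; _-_; _∈_; _∉_; ∣_∣)
open import Data.Fin.Subset.Properties using (∈⊤; ∣⊤∣≡n; x∈p∧x≢y⇒x∈p-y; x∈p⇒∣p-x∣<∣p∣)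
open import Data.Product using (∃; _×_; _,_; proj₂; map₂; uncurry)
open import Data.Sum using (_⊎_; inj₁; inj₂)
open import Data.Vec using (Vec; toList)
open import Data.Vec.Properties using (length-toList)
open import Data.List using (List; []; _∷_; length; map)
open import Data.List.Properties using (length-map)
open import Data.List.Relation.Unary.All as All using (All; []; _∷_)
open import Data.List.Relation.Unary.All.Properties using (anti-mono)
open import Data.List.Relation.Unary.AllPairs using ([]; _∷_)
open import Data.List.Relation.Unary.Any using (here; there)
open import Data.List.Relation.Unary.Unique.Propositional using (Unique)
open import Data.List.Relation.Unary.Unique.Propositional.Properties using (Unique[x∷xs]⇒x∉xs)
open import Data.List.Relation.Binary.Permutation.Propositional using (_↭_; refl; prep; swap; ↭⇒↭ₛ)
open import Data.List.Relation.Binary.Permutation.Setoid.Properties using (Unique-resp-↭)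
open import Data.List.Membership.Propositional using () renaming (_∈_ to _∈ₗ_; _∉_ to _∉ₗ_)
open import Data.List.Membership.Propositional.Properties using (∈-map⁻)
open import Data.Empty using (⊥-elim)
open import Relation.Nullary using (¬_; yes; no)
open import Relation.Binary.PropositionalEquality as ≡
  using (_≡_; _≢_; refl; cong; subst; ≢-sym; setoid)
open import Function.Base using (_∘_)
open import Function.Bundles using (_⇔_; mk⇔; Equivalence)

open Equivalence using (to; from)

Adj⇒≢ : ∀ {n} (G : Graph n) {a b} → Adj G a b → a ≢ b
Adj⇒≢ G ab refl = irrefl G ab

PairsDisjoint : ∀ {n} → Fin n × Fin n → Fin n × Fin n → Set
PairsDisjoint (a , b) (c , d) = a ≢ c × a ≢ d × b ≢ c × b ≢ d

PairsDisjoint-sym : ∀ {n} {p q : Fin n × Fin n} → PairsDisjoint p q → PairsDisjoint q p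
PairsDisjoint-sym (a≢c , a≢d , b≢c , b≢d) = ≢-sym a≢c , ≢-sym b≢c , ≢-sym a≢d , ≢-sym b≢d

module _ {n : ℕ} where

  ∈-endpoints₁ : ∀ {O : List (Fin n × Fin n)} {a b} → (a , b) ∈ₗ O → a ∈ₗ endpoints O
  ∈-endpoints₁ (here refl) = here refl
  ∈-endpoints₁ {_ ∷ _} (there p) = there (there (∈-endpoints₁ p))

  ∈-endpoints₂ : ∀ {O : List (Fin n × Fin n)} {a b} → (a , b) ∈ₗ O → b ∈ₗ endpoints O
  ∈-endpoints₂ (here refl) = there (here refl)
  ∈-endpoints₂ {_ ∷ _} (there p) = there (there (∈-endpoints₂ p))

  ∉-endpoints⇒PairsDisjoint : ∀ {O} {a b c d : Fin n} →
                              All (a ≢_) (b ∷ endpoints O) → All (b ≢_) (endpoints O) →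
                              (c , d) ∈ₗ O → PairsDisjoint (a , b) (c , d)
  ∉-endpoints⇒PairsDisjoint (_ ∷ a∉) b∉ q =
    All.lookup a∉ (∈-endpoints₁ q) , All.lookup a∉ (∈-endpoints₂ q) ,
    All.lookup b∉ (∈-endpoints₁ q) , All.lookup b∉ (∈-endpoints₂ q)

  ≡⊎PairsDisjoint : ∀ {O : List (Fin n × Fin n)} {p q} → Unique (endpoints O) →
                    p ∈ₗ O → q ∈ₗ O → p ≡ q ⊎ PairsDisjoint p q
  ≡⊎PairsDisjoint _                   (here refl) (here refl) = inj₁ refl
  ≡⊎PairsDisjoint (a∉ ∷ b∉ ∷ _)       (here refl) (there q)   =
    inj₂ (∉-endpoints⇒PairsDisjoint a∉ b∉ q)
  ≡⊎PairsDisjoint (a∉ ∷ b∉ ∷ _)       (there p)   (here refl) =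
    inj₂ (PairsDisjoint-sym (∉-endpoints⇒PairsDisjoint a∉ b∉ p))
  ≡⊎PairsDisjoint {_ ∷ _} (_ ∷ _ ∷ U) (there p)   (there q)   = ≡⊎PairsDisjoint U p q

  heads : List (Fin n × Fin n) → List (Fin n)
  heads = map proj₂

  heads⊆endpoints : ∀ {O x} → x ∈ₗ heads O → x ∈ₗ endpoints O
  heads⊆endpoints x∈ with ∈-map⁻ proj₂ x∈
  ... | _ , p , refl = ∈-endpoints₂ p

  heads-Unique : ∀ {O} → Unique (endpoints O) → Unique (heads O)
  heads-Unique {[]}    []            = []
  heads-Unique {_ ∷ _} (_ ∷ b∉ ∷ U) = anti-mono heads⊆endpoints b∉ ∷ heads-Unique U

  without : List (Fin n) → Subset n
  without []       = ⊤
  without (h ∷ hs) = without hs - h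

  ∉⇒∈-without : ∀ {x hs} → x ∉ₗ hs → x ∈ without hs
  ∉⇒∈-without {hs = []}     _   = ∈⊤
  ∉⇒∈-without {hs = _ ∷ hs} x∉ = x∈p∧x≢y⇒x∈p-y (∉⇒∈-without (x∉ ∘ there)) (x∉ ∘ here)

  ∉-without⇒∈ : ∀ {x hs} → x ∉ without hs → x ∈ₗ hs
  ∉-without⇒∈ {hs = []} x∉ = ⊥-elim (x∉ ∈⊤)
  ∉-without⇒∈ {x} {h ∷ hs} x∉ with x ≟ h
  ... | yes x≡h = here x≡h
  ... | no x≢h  = there (∉-without⇒∈ (λ x∈ → x∉ (x∈p∧x≢y⇒x∈p-y x∈ x≢h)))

  ∣without∣+length≤n : ∀ {hs} → Unique hs → ∣ without hs ∣ + length hs ≤ n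
  ∣without∣+length≤n {[]} [] = ≤-reflexive (≡.trans (+-identityʳ _) (∣⊤∣≡n n))
  ∣without∣+length≤n {h ∷ hs} U@(_ ∷ U′) = begin
    ∣ without hs - h ∣ + suc (length hs)  ≡⟨ +-suc _ (length hs) ⟩
    suc (∣ without hs - h ∣ + length hs)  ≤⟨ +-monoˡ-≤ (length hs) ∣without-h∣<∣without∣ ⟩
    ∣ without hs ∣ + length hs            ≤⟨ ∣without∣+length≤n U′ ⟩
    n                                     ∎
    where
    open ≤-Reasoning
    ∣without-h∣<∣without∣ = x∈p⇒∣p-x∣<∣p∣ (∉⇒∈-without (Unique[x∷xs]⇒x∉xs U))

module _ {n} (G : Graph n) (noC4 : ¬ ContainsC4 G) where

  common-neighbours-≡ : ∀ {u v w x} → u ≢ v →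
                        Adj G w u → Adj G w v → Adj G x u → Adj G x v → w ≡ x
  common-neighbours-≡ {u} {v} {w} {x} u≢v wu wv xu xv with w ≟ x
  ... | yes w≡x = w≡x
  ... | no w≢x  = ⊥-elim (noC4 (u , w , v , x , distinct , sym G wu , wv , sym G xv , xu))
    where
    distinct = Adj⇒≢ G (sym G wu) , u≢v , Adj⇒≢ G (sym G xu) ,
               Adj⇒≢ G wv , w≢x , Adj⇒≢ G (sym G xv)

  module _ {In : Rel n} (In⊆Adj : ∀ {w u} → In w u → Adj G w u) where

    IsLD⇒IsLD-Adj : ∀ {S} → IsLD In S → IsLD (Adj G) S
    IsLD⇒IsLD-Adj {S} (dominating , locating) = dominatingAdj , locatingAdj
      where
      dominatingAdj : ∀ u → u ∉ S → ∃ λ w → w ∈ S × Adj G w u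
      dominatingAdj u u∉S = map₂ (map₂ In⊆Adj) (dominating u u∉S)

      locatingAdj : ∀ u v → u ∉ S → v ∉ S → u ≢ v →
                    ¬ (∀ w → w ∈ S → (Adj G w u ⇔ Adj G w v))
      locatingAdj u v u∉S v∉S u≢v sameAdj
        with dominating u u∉S | dominating v v∉S
      ... | w , w∈S , wu | w′ , w′∈S , w′v = locating u v u∉S v∉S u≢v sameIn
        where
        only-w : ∀ {x} → x ∈ S → Adj G x u → x ≡ w
        only-w x∈S xu = common-neighbours-≡ u≢v xu (to (sameAdj _ x∈S) xu)
                          (In⊆Adj wu) (to (sameAdj w w∈S) (In⊆Adj wu))

        wv : In w v
        wv = subst (λ z → In z v) (only-w w′∈S (from (sameAdj w′ w′∈S) (In⊆Adj w′v))) w′v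

        sameIn : ∀ x → x ∈ S → (In x u ⇔ In x v)
        sameIn x x∈S = mk⇔
          (λ xu → subst (λ z → In z v) (≡.sym (only-w x∈S (In⊆Adj xu))) wv)
          (λ xv → subst (λ z → In z u)
                    (≡.sym (only-w x∈S (from (sameAdj x x∈S) (In⊆Adj xv)))) wu)

    without-heads-IsLD : ∀ {O} → All (uncurry In) O → Unique (endpoints O) →
                         IsLD In (without (heads O))
    without-heads-IsLD {O} arcs unique = dominating , locating
      where
      S = without (heads O)

      edge : ∀ {t u} → (t , u) ∈ₗ O → Adj G t u
      edge = In⊆Adj ∘ All.lookup arcs

      tail-of : ∀ {u} → u ∉ S → ∃ λ t → (t , u) ∈ₗ O
      tail-of u∉S with ∈-map⁻ proj₂ (∉-without⇒∈ u∉S)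
      ... | (t , _) , tu , refl = t , tu

      tail∈S : ∀ {t u} → (t , u) ∈ₗ O → t ∈ S
      tail∈S {t} tu = ∉⇒∈-without t∉heads
        where
        t∉heads : t ∉ₗ heads O
        t∉heads t∈heads with ∈-map⁻ proj₂ t∈heads
        ... | (s , _) , st , refl with ≡⊎PairsDisjoint unique tu st
        ...   | inj₁ tu≡st         = Adj⇒≢ G (edge tu) (≡.sym (cong proj₂ tu≡st))
        ...   | inj₂ (_ , t≢t , _) = t≢t refl

      dominating : ∀ u → u ∉ S → ∃ λ w → w ∈ S × In w u
      dominating u u∉S with tail-of u∉S
      ... | t , tu = t , tail∈S tu , All.lookup arcs tu

      locating : ∀ u v → u ∉ S → v ∉ S → u ≢ v → ¬ (∀ w → w ∈ S → (In w u ⇔ In w v))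
      locating u v u∉S v∉S u≢v same with tail-of u∉S | tail-of v∉S
      ... | t , tu | t′ , t′v with ≡⊎PairsDisjoint unique tu t′v
      ...   | inj₁ tu≡t′v      = u≢v (cong proj₂ tu≡t′v)
      ...   | inj₂ (t≢t′ , _)  = t≢t′ (common-neighbours-≡ u≢v (edge tu) tv t′u (edge t′v))
        where
        tv  = In⊆Adj (to (same t (tail∈S tu)) (All.lookup arcs tu))
        t′u = In⊆Adj (from (same t′ (tail∈S t′v)) (All.lookup arcs t′v))

module _ {n} {G : Graph n} (D : Orientation G) where

  orient : ∀ L → All (uncurry (Adj G)) L →
           ∃ λ O → All (uncurry (Arc D)) O × endpoints L ↭ endpoints O × length O ≡ length L
  orient []            []         = [] , [] , refl , refl
  orient ((a , b) ∷ L) (ab ∷ adj) with orient L adj | covers D ab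
  ... | O , arcs , L↭O , len | inj₁ a→b =
    (a , b) ∷ O , a→b ∷ arcs , prep a (prep b L↭O) , cong suc len
  ... | O , arcs , L↭O , len | inj₂ b→a =
    (b , a) ∷ O , b→a ∷ arcs , swap a b L↭O , cong suc len

  LD-set-without-matching-heads : ¬ ContainsC4 G → ∀ {m} {M : Vec (Fin n × Fin n) m} →
                                  IsMatching G M → ∃ λ S → IsLD (Arc D) S × ∣ S ∣ ≤ n ∸ m
  LD-set-without-matching-heads noC4 {m} {M} (M-edges , M-unique)
    with orient (toList M) M-edges
  ... | O , arcs , M↭O , len =
    without (heads O) ,
    without-heads-IsLD G noC4 (arc⊆edge D) arcs O-unique ,
    m+n≤o⇒m≤o∸n _ (subst (λ k → ∣ without (heads O) ∣ + k ≤ n) length-heads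
                       (∣without∣+length≤n (heads-Unique {O = O} O-unique)))
    where
    O-unique : Unique (endpoints O)
    O-unique = Unique-resp-↭ (setoid (Fin n)) (↭⇒↭ₛ M↭O) M-unique

    length-heads : length (heads O) ≡ m
    length-heads = begin
      length (heads O)  ≡⟨ length-map proj₂ O ⟩
      length O          ≡⟨ len ⟩
      length (toList M) ≡⟨ length-toList M ⟩
      m                 ∎
      where open ≡.≡-Reasoning

lemma33 : ∀ {n} (G : Graph n) → ¬ ContainsC4 G →
          ∀ γ Γ α′ → IsγLDGraph G γ → IsΓLD G Γ → IsMatchingNumber G α′ →
          γ ≤ Γ × Γ ≤ n ∸ α′
lemma33 G noC4 γ Γ α′ (_ , γ-minimal) ((D , (S , S-LD , ∣S∣≡Γ) , Γ-minimal) , _)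
        ((M , M-matching) , _)
  with LD-set-without-matching-heads D noC4 M-matching
... | S′ , S′-LD , ∣S′∣≤n∸α′ =
  subst (γ ≤_) ∣S∣≡Γ (γ-minimal S (IsLD⇒IsLD-Adj G noC4 (arc⊆edge D) S-LD)) ,
  ≤-trans (Γ-minimal S′ S′-LD) ∣S′∣≤n∸α′
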